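{- Let $G$ be a finite simple graph, $\mathbb{F}$ a field, and $\{X_v\subseteq\mathbb{F}^n: v\in V(G)\}$ a dual $(n,d)$-representation of $G$ over $\mathbb{F}$. Let $A,B\subseteq V(G)$ be disjoint vertex sets such that every vertex of $A$ is adjacent to every vertex of $B$, and such that $B$ is a clique. Then $\dim(X_A+X_B)=\dim X_A+|B|d$, where $X_S=\sum_{v\in S}X_v$ for $S\subseteq V(G)$.
   Context: For a field $\mathbb{F}$, a collection $\{X_v\subseteq\mathbb{F}^n : v\in V(G)\}$ is a dual $(n,d)$-representation of $G$ over $\mathbb{F}$ if for every vertex $v$: $X_v$ is a subspace of $\mathbb{F}^n$, $\dim X_v=d$, and $X_v\cap\left(\sum_{w\in N(v)}X_w\right)=\{0\}$, where $N(v)$ is the neighborhood of $v$ and the sum is the subspace sum. -}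

module Defs where

open import Level using (Level; _⊔_; suc)
open import Data.Nat using (ℕ; zero) renaming (suc to sucℕ)
open import Data.Fin using (Fin) renaming (zero to fzero; suc to fsuc)
open import Data.Fin.Subset using (Subset; _∈_)
open import Data.Product using (Σ; ∃; _×_; _,_)
open import Data.Sum using (_⊎_)
open import Relation.Nullary using (¬_)
open import Relation.Binary.PropositionalEquality using (_≡_)
open import Algebra.Bundles using (CommutativeRing)

record Field (c ℓ : Level) : Set (suc (c ⊔ ℓ)) where
  field
    commutativeRing : CommutativeRing c ℓ
  open CommutativeRing commutativeRing public
  field
    0≉1     : ¬ (0# ≈ 1#)
    inverse : ∀ x → ¬ (x ≈ 0#) → Σ Carrier (λ y → (x * y) ≈ 1#)

record SimpleGraph (m : ℕ) : Set₁ where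
  field
    Adj    : Fin m → Fin m → Set
    sym    : ∀ {u v} → Adj u v → Adj v u
    irrefl : ∀ {v} → ¬ Adj v v

module LinAlg {c ℓ : Level} (F : Field c ℓ) where
  open Field F

  Vecᶠ : ℕ → Set c
  Vecᶠ n = Fin n → Carrier

  0ᵥ : ∀ {n} → Vecᶠ n
  0ᵥ _ = 0#

  _+ᵥ_ : ∀ {n} → Vecᶠ n → Vecᶠ n → Vecᶠ n
  (x +ᵥ y) i = x i + y i

  _·ᵥ_ : ∀ {n} → Carrier → Vecᶠ n → Vecᶠ n
  (a ·ᵥ x) i = a * x i

  _≈ᵥ_ : ∀ {n} → Vecᶠ n → Vecᶠ n → Set ℓ
  x ≈ᵥ y = ∀ i → x i ≈ y i

  sumᵥ : ∀ {n k} → (Fin k → Vecᶠ n) → Vecᶠ n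
  sumᵥ {k = zero}   f = 0ᵥ
  sumᵥ {k = sucℕ k} f = f fzero +ᵥ sumᵥ (λ i → f (fsuc i))

  record IsSubspace {p} {n : ℕ} (X : Vecᶠ n → Set p) : Set (c ⊔ ℓ ⊔ p) where
    field
      resp  : ∀ {x y} → x ≈ᵥ y → X x → X y
      zero∈ : X 0ᵥ
      +∈    : ∀ {x y} → X x → X y → X (x +ᵥ y)
      ·∈    : ∀ a {x} → X x → X (a ·ᵥ x)

  LinIndep : ∀ {n k} → (Fin k → Vecᶠ n) → Set (c ⊔ ℓ)
  LinIndep b = ∀ (a : Fin _ → Carrier) →
    sumᵥ (λ i → a i ·ᵥ b i) ≈ᵥ 0ᵥ → ∀ i → a i ≈ 0#

  InSpan : ∀ {n k} → (Fin k → Vecᶠ n) → Vecᶠ n → Set (c ⊔ ℓ)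
  InSpan b x = Σ (Fin _ → Carrier) (λ a → x ≈ᵥ sumᵥ (λ i → a i ·ᵥ b i))

  HasDim : ∀ {p n} → (Vecᶠ n → Set p) → ℕ → Set (c ⊔ ℓ ⊔ p)
  HasDim {n = n} X d = Σ (Fin d → Vecᶠ n) λ b →
    LinIndep b × (∀ i → X (b i)) × (∀ x → X x → InSpan b x)

  _⊕_ : ∀ {p q n} → (Vecᶠ n → Set p) → (Vecᶠ n → Set q) → Vecᶠ n → Set (c ⊔ ℓ ⊔ p ⊔ q)
  (X ⊕ Y) x = Σ _ λ y → Σ _ λ z → X y × Y z × (x ≈ᵥ (y +ᵥ z))

  -- X_S = Σ_{v ∈ S} X_v, for a family indexed by Fin m and S ⊆ Fin m given
  -- as a predicate: x = Σ_w y_w with y_w ∈ X_w for w ∈ S and y_w = 0 otherwise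
  SubSum : ∀ {p s n m} → (Fin m → Vecᶠ n → Set p) → (Fin m → Set s) →
           Vecᶠ n → Set (c ⊔ ℓ ⊔ p ⊔ s)
  SubSum {n = n} {m = m} X S x = Σ (Fin m → Vecᶠ n) λ y →
    (∀ w → (S w × X w (y w)) ⊎ (y w ≈ᵥ 0ᵥ)) × (x ≈ᵥ sumᵥ y)

  X[_]_ : ∀ {p n m} → (Fin m → Vecᶠ n → Set p) → Subset m → Vecᶠ n → Set (c ⊔ ℓ ⊔ p)
  X[ X ] S = SubSum X (_∈ S)

  DualRep : ∀ {p m} → SimpleGraph m → (n d : ℕ) → (Fin m → Vecᶠ n → Set p) → Set (c ⊔ ℓ ⊔ p)
  DualRep G n d X = ∀ v →
    IsSubspace (X v) × HasDim (X v) d ×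
    (∀ x → X v x → SubSum X (SimpleGraph.Adj G v) x → x ≈ᵥ 0ᵥ)

{-# OPTIONS --safe #-}
-- Add the spaces X_b, b ∈ B, to X_A one vertex at a time. The sum built so far lies in
-- X_A + X_(B - b), and both A and B - b are contained in the neighbourhood of b (A is complete
-- to B, B is a clique), so duality makes X_b meet it only in 0. A sum of two subspaces meeting
-- only in 0 has a basis obtained by concatenating bases, so every step adds exactly d.
module Submission where

open import Defs
open import Level using (Level)
open import Data.Nat using (ℕ; zero; suc; _+_; _*_)
open import Data.Nat.Properties using (+-identityʳ; +-assoc)
open import Data.Fin using (Fin; _↑ˡ_; _↑ʳ_; splitAt; join) renaming (zero to fzero; suc to fsuc)
open import Data.Fin.Properties using (join-splitAt)
open import Data.Fin.Subset using (Subset; _∈_; _-_; ∣_∣; ⁅_⁆; inside; outside)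
open import Data.Fin.Subset.Properties using (drop-there; p─q⊆p)
open import Data.Vec using (_∷_; []; here; there)
import Data.Vec.Functional as Vector
open import Data.Vec.Functional.Properties using (lookup-++ˡ; lookup-++ʳ)
open import Data.Product using (_×_; _,_; proj₁; proj₂)
import Data.Product as Product
open import Data.Sum using (_⊎_; inj₁; inj₂; [_,_])
import Data.Sum as Sum
open import Function using (_∘_)
open import Relation.Nullary using (¬_)
open import Relation.Unary using (Pred; _⊆_; _≐_)
open import Relation.Unary.Properties using (≐-sym; ≐-trans)
open import Relation.Binary.PropositionalEquality as ≡ using (_≡_; _≢_; _≗_)
import Algebra.Construct.Pointwise as Pointwise
open import Algebra.Bundles using (CommutativeRing)

x∈p-y⇒x≢y : ∀ {m} {x y : Fin m} (p : Subset m) → x ∈ p - y → x ≢ y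
x∈p-y⇒x≢y {y = fzero}  (_ ∷ p) ()         ≡.refl
x∈p-y⇒x≢y {y = fsuc y} (_ ∷ p) (there x∈) ≡.refl = x∈p-y⇒x≢y p x∈ ≡.refl

↑-cases : ∀ {a k d} {P : Fin (k + d) → Set a} →
  (∀ j → P (j ↑ˡ d)) → (∀ j → P (k ↑ʳ j)) → ∀ i → P i
↑-cases {k = k} {d} {P} left right i =
  ≡.subst P (join-splitAt k d i) ([_,_] {C = P ∘ join k d} left right (splitAt k i))

module Subspaces {c ℓ : Level} (F : Field c ℓ) where
  open Field F using (Carrier; 1#; -_; commutativeRing)
  open LinAlg F
  open IsSubspace

  -- Vecᶠ n as a pointwise ring: its ≈, + and 0# unfold to ≈ᵥ, +ᵥ and 0ᵥ, and (λ _ → a) * x to a ·ᵥ x.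
  private
    module V {n} = CommutativeRing (Pointwise.commutativeRing (Fin n) commutativeRing)
    variable
      m k d : ℕ
      p q r s : Level

  module _ {n : ℕ} where

    open import Algebra.Properties.CommutativeSemigroup (V.+-commutativeSemigroup {n}) using (interchange)
    open import Algebra.Properties.Group (V.+-group {n}) using (inverseˡ-unique)
    open import Algebra.Properties.Ring (V.ring {n}) using (-1*x≈-x)
    open import Relation.Binary.Reasoning.Setoid (V.setoid {n})

    sumᵥ-cong : {f g : Fin k → Vecᶠ n} → (∀ i → f i ≈ᵥ g i) → sumᵥ f ≈ᵥ sumᵥ g
    sumᵥ-cong {zero}  f≈g = V.refl
    sumᵥ-cong {suc k} f≈g = V.+-cong (f≈g fzero) (sumᵥ-cong (f≈g ∘ fsuc))

    sumᵥ-zero : ∀ k → sumᵥ {n = n} {k = k} (λ _ → 0ᵥ) ≈ᵥ 0ᵥ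
    sumᵥ-zero zero    = V.refl
    sumᵥ-zero (suc k) = V.trans (V.+-identityˡ _) (sumᵥ-zero k)

    sumᵥ-+ : (f g : Fin k → Vecᶠ n) → sumᵥ (λ i → f i +ᵥ g i) ≈ᵥ (sumᵥ f +ᵥ sumᵥ g)
    sumᵥ-+ {zero}  f g = V.sym (V.+-identityˡ _)
    sumᵥ-+ {suc k} f g =
      V.trans (V.+-cong V.refl (sumᵥ-+ (f ∘ fsuc) (g ∘ fsuc))) (interchange _ _ _ _)

    sumᵥ-· : ∀ a (f : Fin k → Vecᶠ n) → sumᵥ (λ i → a ·ᵥ f i) ≈ᵥ (a ·ᵥ sumᵥ f)
    sumᵥ-· {zero}  a f = V.sym (V.zeroʳ _)
    sumᵥ-· {suc k} a f = V.trans (V.+-cong V.refl (sumᵥ-· a (f ∘ fsuc))) (V.sym (V.distribˡ _ _ _))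

    sumᵥ-↑ : (h : Fin (k + d) → Vecᶠ n) → sumᵥ h ≈ᵥ (sumᵥ (h ∘ (_↑ˡ d)) +ᵥ sumᵥ (h ∘ (k ↑ʳ_)))
    sumᵥ-↑ {zero}  h = V.sym (V.+-identityˡ _)
    sumᵥ-↑ {suc k} h = V.trans (V.+-cong V.refl (sumᵥ-↑ {k} (h ∘ fsuc))) (V.sym (V.+-assoc _ _ _))

    lincomb : (Fin k → Carrier) → (Fin k → Vecᶠ n) → Vecᶠ n
    lincomb a e = sumᵥ (λ i → a i ·ᵥ e i)

    lincomb-cong : {a a′ : Fin k → Carrier} {e e′ : Fin k → Vecᶠ n} →
      a ≗ a′ → e ≗ e′ → lincomb a e ≈ᵥ lincomb a′ e′
    lincomb-cong a≗a′ e≗e′ = sumᵥ-cong (λ i → V.reflexive (≡.cong₂ _·ᵥ_ (a≗a′ i) (e≗e′ i)))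

    lincomb-++ : (a : Fin (k + d) → Carrier) (e : Fin k → Vecᶠ n) (f : Fin d → Vecᶠ n) →
      lincomb a (e Vector.++ f) ≈ᵥ (lincomb (a ∘ (_↑ˡ d)) e +ᵥ lincomb (a ∘ (k ↑ʳ_)) f)
    lincomb-++ {k = k} a e f = V.trans (sumᵥ-↑ {k = k} _)
      (V.+-cong (lincomb-cong (λ _ → ≡.refl) (lookup-++ˡ e f))
                (lincomb-cong (λ _ → ≡.refl) (lookup-++ʳ e f)))

    Disjoint : Pred (Vecᶠ n) p → Pred (Vecᶠ n) q → Set _
    Disjoint P Q = ∀ {x} → P x → Q x → x ≈ᵥ 0ᵥ

    ⊕-mono : {P : Pred (Vecᶠ n) p} {Q : Pred (Vecᶠ n) q} {P′ : Pred (Vecᶠ n) r} {Q′ : Pred (Vecᶠ n) s} →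
      P ⊆ P′ → Q ⊆ Q′ → P ⊕ Q ⊆ P′ ⊕ Q′
    ⊕-mono P⊆P′ Q⊆Q′ (y , z , y∈P , z∈Q , x≈y+z) = y , z , P⊆P′ y∈P , Q⊆Q′ z∈Q , x≈y+z

    ⊕-congˡ : {P : Pred (Vecᶠ n) p} {Q : Pred (Vecᶠ n) q} {Q′ : Pred (Vecᶠ n) r} →
      Q ≐ Q′ → P ⊕ Q ≐ P ⊕ Q′
    ⊕-congˡ (Q⊆Q′ , Q′⊆Q) = ⊕-mono (λ x∈P → x∈P) Q⊆Q′ , ⊕-mono (λ x∈P → x∈P) Q′⊆Q

    module _ {P : Pred (Vecᶠ n) p} {Q : Pred (Vecᶠ n) q} where

      P⊆P⊕Q : Q 0ᵥ → P ⊆ P ⊕ Q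
      P⊆P⊕Q 0∈Q {x} x∈P = x , 0ᵥ , x∈P , 0∈Q , V.sym (V.+-identityʳ x)

      Q⊆P⊕Q : P 0ᵥ → Q ⊆ P ⊕ Q
      Q⊆P⊕Q 0∈P {x} x∈Q = 0ᵥ , x , 0∈P , x∈Q , V.sym (V.+-identityˡ x)

      ⊕-least : {U : Pred (Vecᶠ n) r} → IsSubspace U → P ⊆ U → Q ⊆ U → P ⊕ Q ⊆ U
      ⊕-least U-sub P⊆U Q⊆U (y , z , y∈P , z∈Q , x≈y+z) =
        resp U-sub (V.sym x≈y+z) (+∈ U-sub (P⊆U y∈P) (Q⊆U z∈Q))

      ⊕-assoc : {R : Pred (Vecᶠ n) r} → (P ⊕ Q) ⊕ R ≐ P ⊕ (Q ⊕ R)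
      ⊕-assoc = assocʳ , assocˡ
        where
        assocʳ : (P ⊕ Q) ⊕ _ ⊆ P ⊕ (Q ⊕ _)
        assocʳ (_ , z , (x , y , x∈P , y∈Q , w≈x+y) , z∈R , v≈w+z) =
          x , y +ᵥ z , x∈P , (y , z , y∈Q , z∈R , V.refl) ,
          V.trans v≈w+z (V.trans (V.+-cong w≈x+y V.refl) (V.+-assoc x y z))
        assocˡ : P ⊕ (Q ⊕ _) ⊆ (P ⊕ Q) ⊕ _
        assocˡ (x , _ , x∈P , (y , z , y∈Q , z∈R , w≈y+z) , v≈x+w) =
          x +ᵥ y , z , (x , y , x∈P , y∈Q , V.refl) , z∈R ,
          V.trans v≈x+w (V.trans (V.+-cong V.refl w≈y+z) (V.sym (V.+-assoc x y z)))

      ⊕-isSubspace : IsSubspace P → IsSubspace Q → IsSubspace (P ⊕ Q)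
      resp (⊕-isSubspace P-sub Q-sub) x≈x′ (y , z , y∈P , z∈Q , x≈y+z) =
        y , z , y∈P , z∈Q , V.trans (V.sym x≈x′) x≈y+z
      zero∈ (⊕-isSubspace P-sub Q-sub) = P⊆P⊕Q (zero∈ Q-sub) (zero∈ P-sub)
      +∈ (⊕-isSubspace P-sub Q-sub) (y , z , y∈P , z∈Q , x≈y+z) (y′ , z′ , y′∈P , z′∈Q , x′≈y′+z′) =
        y +ᵥ y′ , z +ᵥ z′ , +∈ P-sub y∈P y′∈P , +∈ Q-sub z∈Q z′∈Q ,
        V.trans (V.+-cong x≈y+z x′≈y′+z′) (interchange y z y′ z′)
      ·∈ (⊕-isSubspace P-sub Q-sub) a (y , z , y∈P , z∈Q , x≈y+z) =
        a ·ᵥ y , a ·ᵥ z , ·∈ P-sub a y∈P , ·∈ Q-sub a z∈Q ,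
        V.trans (V.*-cong V.refl x≈y+z) (V.distribˡ _ y z)

      Disjoint-+≈0 : IsSubspace Q → Disjoint P Q → ∀ {y z} → P y → Q z → (y +ᵥ z) ≈ᵥ 0ᵥ →
        y ≈ᵥ 0ᵥ × z ≈ᵥ 0ᵥ
      Disjoint-+≈0 Q-sub P∩Q≈0 {y} {z} y∈P z∈Q y+z≈0 = y≈0 , z≈0
        where
        y≈-z : y ≈ᵥ ((- 1#) ·ᵥ z)
        y≈-z = V.trans (inverseˡ-unique y z y+z≈0) (V.sym (-1*x≈-x z))
        y≈0 : y ≈ᵥ 0ᵥ
        y≈0 = P∩Q≈0 y∈P (resp Q-sub (V.sym y≈-z) (·∈ Q-sub (- 1#) z∈Q))
        z≈0 : z ≈ᵥ 0ᵥ
        z≈0 = begin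
          z         ≈⟨ V.+-identityˡ z ⟨
          0ᵥ +ᵥ z   ≈⟨ V.+-cong y≈0 V.refl ⟨
          y +ᵥ z    ≈⟨ y+z≈0 ⟩
          0ᵥ        ∎

    lincomb∈ : {P : Pred (Vecᶠ n) p} → IsSubspace P →
      {e : Fin k → Vecᶠ n} → (∀ i → P (e i)) → ∀ a → P (lincomb a e)
    lincomb∈ {k = zero}  P-sub e∈P a = zero∈ P-sub
    lincomb∈ {k = suc k} P-sub e∈P a =
      +∈ P-sub (·∈ P-sub (a fzero) (e∈P fzero)) (lincomb∈ P-sub (e∈P ∘ fsuc) (a ∘ fsuc))

    HasDim-resp : {P : Pred (Vecᶠ n) p} {Q : Pred (Vecᶠ n) q} → P ≐ Q → HasDim P k → HasDim Q k
    HasDim-resp (P⊆Q , Q⊆P) (e , e-indep , e∈P , e-spans) =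
      e , e-indep , (λ i → P⊆Q (e∈P i)) , (λ x x∈Q → e-spans x (Q⊆P x∈Q))

    HasDim-⊕ : {P : Pred (Vecᶠ n) p} {Q : Pred (Vecᶠ n) q} →
      IsSubspace P → IsSubspace Q → Disjoint P Q → HasDim P k → HasDim Q d → HasDim (P ⊕ Q) (k + d)
    HasDim-⊕ {k = k} {d = d} {P = P} {Q = Q} P-sub Q-sub P∩Q≈0
      (e , e-indep , e∈P , e-spans) (f , f-indep , f∈Q , f-spans) =
      e Vector.++ f , indep , e++f∈P⊕Q , spans
      where
      e++f∈P⊕Q : ∀ i → (P ⊕ Q) ((e Vector.++ f) i)
      e++f∈P⊕Q i with splitAt k i
      ... | inj₁ j = P⊆P⊕Q (zero∈ Q-sub) (e∈P j)
      ... | inj₂ j = Q⊆P⊕Q (zero∈ P-sub) (f∈Q j)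

      indep : LinIndep (e Vector.++ f)
      indep α α·[e++f]≈0 = ↑-cases (e-indep (α ∘ (_↑ˡ d)) (proj₁ parts≈0))
                                       (f-indep (α ∘ (k ↑ʳ_)) (proj₂ parts≈0))
        where
        parts≈0 = Disjoint-+≈0 Q-sub P∩Q≈0 (lincomb∈ P-sub e∈P _) (lincomb∈ Q-sub f∈Q _)
                    (V.trans (V.sym (lincomb-++ α e f)) α·[e++f]≈0)

      spans : ∀ x → (P ⊕ Q) x → InSpan (e Vector.++ f) x
      spans x (y , z , y∈P , z∈Q , x≈y+z) with e-spans y y∈P | f-spans z z∈Q
      ... | a , y≈a·e | b , z≈b·f = a Vector.++ b , (begin
        x                                   ≈⟨ x≈y+z ⟩
        y +ᵥ z                              ≈⟨ V.+-cong y≈a·e z≈b·f ⟩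
        lincomb a e +ᵥ lincomb b f          ≈⟨ V.+-cong (lincomb-cong (lookup-++ˡ a b) (λ _ → ≡.refl))
                                                        (lincomb-cong (lookup-++ʳ a b) (λ _ → ≡.refl)) ⟨
        lincomb ((a Vector.++ b) ∘ (_↑ˡ d)) e +ᵥ lincomb ((a Vector.++ b) ∘ (k ↑ʳ_)) f
                                            ≈⟨ lincomb-++ (a Vector.++ b) e f ⟨
        lincomb (a Vector.++ b) (e Vector.++ f) ∎)

    Summand : (Fin m → Pred (Vecᶠ n) p) → Pred (Fin m) s → Fin m → Pred (Vecᶠ n) _
    Summand Y S w v = (S w × Y w v) ⊎ (v ≈ᵥ 0ᵥ)

    module _ {Y : Fin m → Pred (Vecᶠ n) p} {S : Pred (Fin m) s} where

      Summand-isSubspace : ∀ {w} → IsSubspace (Y w) → IsSubspace (Summand Y S w)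
      resp (Summand-isSubspace Yw-sub) v≈v′ (inj₁ (w∈S , v∈Yw)) = inj₁ (w∈S , resp Yw-sub v≈v′ v∈Yw)
      resp (Summand-isSubspace Yw-sub) v≈v′ (inj₂ v≈0)          = inj₂ (V.trans (V.sym v≈v′) v≈0)
      zero∈ (Summand-isSubspace Yw-sub) = inj₂ V.refl
      +∈ (Summand-isSubspace Yw-sub) (inj₁ (w∈S , u∈Yw)) (inj₁ (_ , v∈Yw)) =
        inj₁ (w∈S , +∈ Yw-sub u∈Yw v∈Yw)
      +∈ (Summand-isSubspace Yw-sub) (inj₁ (w∈S , u∈Yw)) (inj₂ v≈0) =
        inj₁ (w∈S , resp Yw-sub (V.sym (V.trans (V.+-cong V.refl v≈0) (V.+-identityʳ _))) u∈Yw)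
      +∈ (Summand-isSubspace Yw-sub) (inj₂ u≈0) (inj₁ (w∈S , v∈Yw)) =
        inj₁ (w∈S , resp Yw-sub (V.sym (V.trans (V.+-cong u≈0 V.refl) (V.+-identityˡ _))) v∈Yw)
      +∈ (Summand-isSubspace Yw-sub) (inj₂ u≈0) (inj₂ v≈0) =
        inj₂ (V.trans (V.+-cong u≈0 v≈0) (V.+-identityʳ 0ᵥ))
      ·∈ (Summand-isSubspace Yw-sub) a (inj₁ (w∈S , v∈Yw)) = inj₁ (w∈S , ·∈ Yw-sub a v∈Yw)
      ·∈ (Summand-isSubspace Yw-sub) a (inj₂ v≈0) =
        inj₂ (V.trans (V.*-cong V.refl v≈0) (V.zeroʳ _))

      SubSum-isSubspace : (∀ w → IsSubspace (Y w)) → IsSubspace (SubSum Y S)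
      resp (SubSum-isSubspace Y-sub) x≈x′ (y , y∈ , x≈∑y) = y , y∈ , V.trans (V.sym x≈x′) x≈∑y
      zero∈ (SubSum-isSubspace Y-sub) = (λ _ → 0ᵥ) , (λ _ → inj₂ V.refl) , V.sym (sumᵥ-zero m)
      +∈ (SubSum-isSubspace Y-sub) (y , y∈ , x≈∑y) (y′ , y′∈ , x′≈∑y′) =
        (λ w → y w +ᵥ y′ w) , (λ w → +∈ (Summand-isSubspace (Y-sub w)) (y∈ w) (y′∈ w)) ,
        V.trans (V.+-cong x≈∑y x′≈∑y′) (V.sym (sumᵥ-+ y y′))
      ·∈ (SubSum-isSubspace Y-sub) a (y , y∈ , x≈∑y) =
        (λ w → a ·ᵥ y w) , (λ w → ·∈ (Summand-isSubspace (Y-sub w)) a (y∈ w)) ,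
        V.trans (V.*-cong V.refl x≈∑y) (V.sym (sumᵥ-· a y))

      SubSum-mono : {T : Pred (Fin m) r} → S ⊆ T → SubSum Y S ⊆ SubSum Y T
      SubSum-mono S⊆T (y , y∈ , x≈∑y) = y , (λ w → Sum.map₁ (Product.map₁ S⊆T) (y∈ w)) , x≈∑y

    module _ {Y : Fin (suc m) → Pred (Vecᶠ n) p} {S : Subset m} where

      X[]-inside : IsSubspace (Y fzero) → X[ Y ] (inside ∷ S) ≐ Y fzero ⊕ (X[ Y ∘ fsuc ] S)
      X[]-inside Y₀-sub = uncons , cons
        where
        head∈Y₀ : ∀ {v} → Summand Y (_∈ inside ∷ S) fzero v → Y fzero v
        head∈Y₀ (inj₁ (_ , v∈Y₀)) = v∈Y₀
        head∈Y₀ (inj₂ v≈0)        = resp Y₀-sub (V.sym v≈0) (zero∈ Y₀-sub)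
        uncons : X[ Y ] (inside ∷ S) ⊆ Y fzero ⊕ (X[ Y ∘ fsuc ] S)
        uncons (y , y∈ , x≈∑y) =
          y fzero , sumᵥ (y ∘ fsuc) , head∈Y₀ (y∈ fzero) ,
          (y ∘ fsuc , (λ w → Sum.map₁ (Product.map₁ drop-there) (y∈ (fsuc w))) , V.refl) , x≈∑y
        cons : Y fzero ⊕ (X[ Y ∘ fsuc ] S) ⊆ X[ Y ] (inside ∷ S)
        cons (y₀ , z , y₀∈Y₀ , (y , y∈ , z≈∑y) , x≈y₀+z) =
          y₀ Vector.∷ y ,
          (λ { fzero → inj₁ (here , y₀∈Y₀) ; (fsuc w) → Sum.map₁ (Product.map₁ there) (y∈ w) }) ,
          V.trans x≈y₀+z (V.+-cong V.refl z≈∑y)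

      X[]-outside : X[ Y ] (outside ∷ S) ≐ X[ Y ∘ fsuc ] S
      X[]-outside = uncons , cons
        where
        head≈0 : ∀ {v} → Summand Y (_∈ outside ∷ S) fzero v → v ≈ᵥ 0ᵥ
        head≈0 (inj₂ v≈0) = v≈0
        uncons : X[ Y ] (outside ∷ S) ⊆ X[ Y ∘ fsuc ] S
        uncons (y , y∈ , x≈∑y) =
          y ∘ fsuc , (λ w → Sum.map₁ (Product.map₁ drop-there) (y∈ (fsuc w))) ,
          V.trans x≈∑y (V.trans (V.+-cong (head≈0 (y∈ fzero)) V.refl) (V.+-identityˡ _))
        cons : X[ Y ∘ fsuc ] S ⊆ X[ Y ] (outside ∷ S)
        cons (y , y∈ , x≈∑y) =
          0ᵥ Vector.∷ y ,
          (λ { fzero → inj₂ V.refl ; (fsuc w) → Sum.map₁ (Product.map₁ there) (y∈ w) }) ,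
          V.trans x≈∑y (V.sym (V.+-identityˡ _))

    HasDim-⊕-X[] : {Y : Fin m → Pred (Vecᶠ n) p} {P : Pred (Vecᶠ n) q} (S : Subset m) →
      (∀ w → IsSubspace (Y w)) → (∀ w → HasDim (Y w) d) → IsSubspace P → HasDim P k →
      (∀ {b} → b ∈ S → Disjoint (Y b) (P ⊕ (X[ Y ] (S - b)))) →
      HasDim (P ⊕ (X[ Y ] S)) (k + ∣ S ∣ * d)
    HasDim-⊕-X[] {k = k} {Y = Y} {P = P} [] Y-sub _ P-sub P-dim _ =
      ≡.subst (HasDim _) (≡.sym (+-identityʳ k)) (HasDim-resp (≐-sym P⊕X[Y][]≐P) P-dim)
      where
      X[Y][]⊆P : X[ Y ] [] ⊆ P
      X[Y][]⊆P (_ , _ , x≈0) = resp P-sub (V.sym x≈0) (zero∈ P-sub)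
      P⊕X[Y][]≐P : P ⊕ (X[ Y ] []) ≐ P
      P⊕X[Y][]≐P = ⊕-least P-sub (λ x∈P → x∈P) X[Y][]⊆P , P⊆P⊕Q (zero∈ (SubSum-isSubspace Y-sub))
    HasDim-⊕-X[] {d = d} {k = k} {Y = Y} {P = P} (inside ∷ S) Y-sub Y-dim P-sub P-dim Yb∩rest≈0 =
      ≡.subst (HasDim _) (+-assoc k d (∣ S ∣ * d)) (HasDim-resp (≐-sym shift) IH)
      where
      -- (s ∷ S) - fsuc b reduces to s ∷ (S - b), so shift also transports the hypothesis on b.
      shift : ∀ {S} → P ⊕ (X[ Y ] (inside ∷ S)) ≐ (P ⊕ Y fzero) ⊕ (X[ Y ∘ fsuc ] S)
      shift = ≐-trans (⊕-congˡ (X[]-inside {Y = Y} (Y-sub fzero))) (≐-sym ⊕-assoc)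
      P∩Y₀≈0 : Disjoint P (Y fzero)
      P∩Y₀≈0 x∈P x∈Y₀ = Yb∩rest≈0 here x∈Y₀ (P⊆P⊕Q (zero∈ (SubSum-isSubspace Y-sub)) x∈P)
      IH : HasDim ((P ⊕ Y fzero) ⊕ (X[ Y ∘ fsuc ] S)) ((k + d) + ∣ S ∣ * d)
      IH = HasDim-⊕-X[] S (Y-sub ∘ fsuc) (Y-dim ∘ fsuc) (⊕-isSubspace P-sub (Y-sub fzero))
             (HasDim-⊕ P-sub (Y-sub fzero) P∩Y₀≈0 P-dim (Y-dim fzero))
             (λ b∈S x∈Yb x∈rest → Yb∩rest≈0 (there b∈S) x∈Yb (proj₂ shift x∈rest))
    HasDim-⊕-X[] {Y = Y} {P = P} (outside ∷ S) Y-sub Y-dim P-sub P-dim Yb∩rest≈0 =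
      HasDim-resp (≐-sym shift)
        (HasDim-⊕-X[] S (Y-sub ∘ fsuc) (Y-dim ∘ fsuc) P-sub P-dim
          (λ b∈S x∈Yb x∈rest → Yb∩rest≈0 (there b∈S) x∈Yb (proj₂ shift x∈rest)))
      where
      shift : ∀ {S} → P ⊕ (X[ Y ] (outside ∷ S)) ≐ P ⊕ (X[ Y ∘ fsuc ] S)
      shift = ⊕-congˡ (X[]-outside {Y = Y})

proposition1 : ∀ {c ℓ p : Level} (F : Field c ℓ) {m : ℕ} (G : SimpleGraph m) (n d : ℕ)
    (X : Fin m → LinAlg.Vecᶠ F n → Set p) → LinAlg.DualRep F G n d X →
    (A B : Subset m) →
    (∀ v → v ∈ A → ¬ (v ∈ B)) →
    (∀ a b → a ∈ A → b ∈ B → SimpleGraph.Adj G a b) →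
    (∀ b b′ → b ∈ B → b′ ∈ B → ¬ (b ≡ b′) → SimpleGraph.Adj G b b′) →
    ∀ (k : ℕ) → LinAlg.HasDim F (LinAlg.X[_]_ F X A) k →
    LinAlg.HasDim F (LinAlg._⊕_ F (LinAlg.X[_]_ F X A) (LinAlg.X[_]_ F X B)) (k + ∣ B ∣ * d)
proposition1 F G _ d X dual A B _ A-B-adjacent B-clique k dim-X[A] =
  HasDim-⊕-X[] B X-sub X-dim (SubSum-isSubspace X-sub) dim-X[A] X[b]∩rest≈0
  where
  open LinAlg F
  open Subspaces F
  open SimpleGraph G using (Adj)

  X-sub : ∀ w → IsSubspace (X w)
  X-sub w = proj₁ (dual w)

  X-dim : ∀ w → HasDim (X w) d
  X-dim w = proj₁ (proj₂ (dual w))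

  X[b]∩rest≈0 : ∀ {b} → b ∈ B → Disjoint (X b) ((X[ X ] A) ⊕ (X[ X ] (B - b)))
  X[b]∩rest≈0 {b} b∈B x∈Xb x∈rest =
    proj₂ (proj₂ (dual b)) _ x∈Xb
      (⊕-least (SubSum-isSubspace X-sub) (SubSum-mono {Y = X} A⊆N[b]) (SubSum-mono {Y = X} B-b⊆N[b]) x∈rest)
    where
    A⊆N[b] : ∀ {a} → a ∈ A → Adj b a
    A⊆N[b] a∈A = SimpleGraph.sym G (A-B-adjacent _ b a∈A b∈B)
    B-b⊆N[b] : ∀ {w} → w ∈ B - b → Adj b w
    B-b⊆N[b] w∈B-b =
      B-clique b _ b∈B (p─q⊆p B ⁅ b ⁆ w∈B-b) (λ b≡w → x∈p-y⇒x≢y B w∈B-b (≡.sym b≡w))
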